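{- Let $k\ge 1$ be an integer and let $G$ be a graph with minimum degree $\delta(G)\ge k$. Then $\mathrm{TC}_k(G)\ge \delta(G)-k+2$. Moreover, this bound is sharp: there exist graphs attaining equality (for instance, $\mathrm{TC}_2(C_n)=2$ for cycles $C_n$, and $\mathrm{TC}_k(K_n)=n-k+1$ for complete graphs $K_n$ with $n\ge k+1$).
   Context: All graphs are finite, simple and connected. For a vertex $v$, $N(v)$ denotes its open neighborhood. For a graph $G$ with $\delta(G)\ge k$, a set $S\subseteq V(G)$ is a total $k$-dominating set if $|N(v)\cap S|\ge k$ for every $v\in V(G)$. Two disjoint sets $U,W\subseteq V(G)$ form a total $k$-coalition if neither $U$ nor $W$ is a total $k$-dominating set but $U\cup W$ is a total $k$-dominating set. A total $k$-coalition partition of $G$ is a partition $\Omega$ of $V(G)$ such that every set of $\Omega$ forms a total $k$-coalition with some other set of $\Omega$. The total $k$-coalition number $\mathrm{TC}_k(G)$ is the maximum cardinality of a total $k$-coalition partition of $G$. -}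

module Defs where

open import Data.Nat using (ℕ; zero; suc; _+_; _∸_; _≤_; _⊓_; _%_)
open import Data.Nat as ℕ using ()
open import Data.Bool using (Bool; true; false; not; _∨_)
open import Data.Fin using (Fin; toℕ) renaming (zero to fzero; suc to fsuc)
open import Data.Fin as F using ()
open import Data.Fin.Subset using (Subset; _∩_; _∪_; ∣_∣; ⊥)
open import Data.Vec using (tabulate)
open import Data.Product using (Σ; _×_; ∃)
open import Relation.Nullary using (¬_; ⌊_⌋)
open import Relation.Binary.PropositionalEquality using (_≡_; _≢_)
open import Function using (_∘_)

data Walk {n : ℕ} (adj : Fin n → Fin n → Bool) : Fin n → Fin n → Set where
  here : ∀ {u} → Walk adj u u
  step : ∀ {u v w} → adj u v ≡ true → Walk adj v w → Walk adj u w

record Graph (n : ℕ) : Set where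
  field
    adj       : Fin n → Fin n → Bool
    symmetric : ∀ u v → adj u v ≡ adj v u
    loopless  : ∀ u → adj u u ≡ false
    connected : ∀ u v → Walk adj u v

open Graph public

N : ∀ {n} → Graph n → Fin n → Subset n
N G v = tabulate (adj G v)

degree : ∀ {n} → Graph n → Fin n → ℕ
degree G v = ∣ N G v ∣

minFin : ∀ {m} → (Fin (suc m) → ℕ) → ℕ
minFin {zero}  f = f fzero
minFin {suc m} f = f fzero ⊓ minFin (f ∘ fsuc)

δ : ∀ {m} → Graph (suc m) → ℕ
δ G = minFin (degree G)

TotalDominating : ∀ {n} → ℕ → Graph n → Subset n → Set
TotalDominating k G S = ∀ v → k ≤ ∣ N G v ∩ S ∣

TotalCoalition : ∀ {n} → ℕ → Graph n → Subset n → Subset n → Set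
TotalCoalition k G U W =
  (U ∩ W ≡ ⊥) × ¬ TotalDominating k G U × ¬ TotalDominating k G W
    × TotalDominating k G (U ∪ W)

record Partition (n p : ℕ) : Set where
  field
    label      : Fin n → Fin p
    surjective : ∀ i → ∃ λ v → label v ≡ i

open Partition public

part : ∀ {n p} → Partition n p → Fin p → Subset n
part Ω i = tabulate (λ v → ⌊ label Ω v F.≟ i ⌋)

IsTotalCoalitionPartition : ∀ {n p} → ℕ → Graph n → Partition n p → Set
IsTotalCoalitionPartition k G Ω =
  ∀ i → ∃ λ j → (j ≢ i) × TotalCoalition k G (part Ω i) (part Ω j)

HasTCPartition : ∀ {n} → ℕ → Graph n → ℕ → Set
HasTCPartition {n} k G p = Σ (Partition n p) (IsTotalCoalitionPartition k G)

TC≡ : ∀ {n} → ℕ → Graph n → ℕ → Set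
TC≡ k G t = HasTCPartition k G t × (∀ p → HasTCPartition k G p → p ≤ t)

completeAdj : ∀ {n} → Fin n → Fin n → Bool
completeAdj u v = not ⌊ u F.≟ v ⌋

cycleAdj : ∀ {m} → Fin (suc m) → Fin (suc m) → Bool
cycleAdj {m} u v = ⌊ toℕ v ℕ.≟ suc (toℕ u) % suc m ⌋ ∨ ⌊ toℕ u ℕ.≟ suc (toℕ v) % suc m ⌋

-- Lower bound: let v have minimum degree δ and pick δ − k + 1 of its neighbours
-- g₀, …, g_{δ−k}.  The singletons {gᵢ} together with the set R of all other vertices form
-- a total k-coalition partition: v has only k − 1 neighbours in R, so R is not total
-- k-dominating, while R ∪ {gᵢ} misses only δ − k vertices, so every vertex keeps at least
-- k neighbours in it.
-- Sharpness: the parts outside a coalition pair are nonempty and disjoint from its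
-- union, which is total k-dominating; so a partition has at most n − t + 2 parts when every
-- total k-dominating set has at least t vertices.  In the 2-regular cycle V is the only
-- total 2-dominating set (t = n), and in Kₙ any total k-dominating set has t ≥ k + 1.
module Submission where

open import Defs
open import Data.Nat using (ℕ; zero; suc; _+_; _∸_; _≤_; _<_; z≤n; s≤s; s≤s⁻¹)
import Data.Nat as ℕ
open import Data.Nat.Properties
  using ( ≤-refl; ≤-reflexive; ≤-trans; ≤-antisym; <-irrefl; <⇒≱; module ≤-Reasoning
        ; +-comm; +-suc; +-identityʳ; +-mono-≤; +-monoˡ-≤; +-monoʳ-≤; +-monoʳ-<; +-cancelˡ-≤
        ; m≤n+m; m+n≤o⇒n≤o; m≢1+n+m; m⊓n≤m; m⊓n≤n; ⊓-glb; ⊓-sel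
        ; n∸n≡0; m∸n+n≡m; +-∸-assoc; ∸-monoˡ-≤; ∸-monoʳ-≤ )
open import Data.Nat.DivMod using (_%_; n%n≡0; m<n⇒m%n≡m)
open import Data.Bool using (Bool; true; not)
open import Data.Fin
  using (Fin; toℕ; fromℕ; fromℕ<; inject₁; inject≤; punchIn; punchOut)
  renaming (zero to fzero; suc to fsuc)
import Data.Fin as F
open import Data.Fin.Properties
  using ( suc-injective; 0≢1+n; toℕ-injective; toℕ<n; toℕ-fromℕ; toℕ-inject₁; inject≤-injective
        ; punchIn-injective; punchInᵢ≢i; punchIn-punchOut; injective⇒≤; any? )
open import Data.Fin.Relation.Unary.Top using (view; ‵fromℕ; ‵inject₁; view-fromℕ; view-inject₁)
open import Data.Fin.Subset
open import Data.Fin.Subset.Properties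
open import Data.Vec using (_∷_; []; here; there; tabulate)
open import Data.Vec.Properties using (lookup∘tabulate; lookup⇒[]=; []=⇒lookup)
open import Data.Product using (Σ; _×_; ∃; _,_; proj₁; proj₂)
open import Data.Sum using (_⊎_; inj₁; inj₂)
open import Function using (_∘_; case_of_)
open import Function.Definitions using (Injective)
open import Relation.Nullary using (¬_; Dec; yes; no; ⌊_⌋; contradiction)
open import Relation.Nullary.Decidable using (dec-true; dec-false; isYes≗does)
open import Relation.Binary.PropositionalEquality

record Enumeration {n} (p : Subset n) : Set where
  field
    elem      : Fin ∣ p ∣ → Fin n
    injective : Injective _≡_ _≡_ elem
    elem∈     : ∀ j → elem j ∈ p
    onto      : ∀ {x} → x ∈ p → ∃ λ j → elem j ≡ x

enumerate : ∀ {n} (p : Subset n) → Enumeration p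
enumerate [] = record { elem = λ () ; injective = λ {} ; elem∈ = λ () ; onto = λ () }
enumerate (outside ∷ p) = record
  { elem = fsuc ∘ elem
  ; injective = injective ∘ suc-injective
  ; elem∈ = there ∘ elem∈
  ; onto = λ { (there x∈p) → let j , eq = onto x∈p in j , cong fsuc eq }
  }
  where open Enumeration (enumerate p)
enumerate (inside ∷ p) = record
  { elem = elem′
  ; injective = elem′-injective
  ; elem∈ = λ { fzero → here ; (fsuc j) → there (elem∈ j) }
  ; onto = λ { here → fzero , refl ; (there x∈p) → let j , eq = onto x∈p in fsuc j , cong fsuc eq }
  }
  where
  open Enumeration (enumerate p)
  elem′ : Fin (suc ∣ p ∣) → Fin (suc _)
  elem′ fzero    = fzero
  elem′ (fsuc j) = fsuc (elem j)
  elem′-injective : Injective _≡_ _≡_ elem′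
  elem′-injective {fzero}  {fzero}  _  = refl
  elem′-injective {fsuc _} {fsuc _} eq = cong fsuc (injective (suc-injective eq))

injection⇒≤∣p∣ : ∀ {n q} {p : Subset n} (g : Fin q → Fin n) →
  Injective _≡_ _≡_ g → (∀ i → g i ∈ p) → q ≤ ∣ p ∣
injection⇒≤∣p∣ {p = p} g g-inj g∈p = injective⇒≤ index-injective
  where
  open Enumeration (enumerate p)
  index : ∀ i → ∃ λ j → elem j ≡ g i
  index i = onto (g∈p i)
  index-injective : Injective _≡_ _≡_ (proj₁ ∘ index)
  index-injective {i} {i′} eq = g-inj (begin
    g i                     ≡⟨ proj₂ (index i) ⟨
    elem (proj₁ (index i))  ≡⟨ cong elem eq ⟩
    elem (proj₁ (index i′)) ≡⟨ proj₂ (index i′) ⟩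
    g i′                    ∎)
    where open ≡-Reasoning

covering⇒∣p∣≤ : ∀ {n q} {p : Subset n} (g : Fin q → Fin n) →
  (∀ {x} → x ∈ p → ∃ λ i → g i ≡ x) → ∣ p ∣ ≤ q
covering⇒∣p∣≤ {p = p} g covers = injective⇒≤ preimage-injective
  where
  open Enumeration (enumerate p)
  preimage : ∀ j → ∃ λ i → g i ≡ elem j
  preimage j = covers (elem∈ j)
  preimage-injective : Injective _≡_ _≡_ (proj₁ ∘ preimage)
  preimage-injective {j} {j′} eq = injective (begin
    elem j                  ≡⟨ proj₂ (preimage j) ⟨
    g (proj₁ (preimage j))  ≡⟨ cong g eq ⟩
    g (proj₁ (preimage j′)) ≡⟨ proj₂ (preimage j′) ⟩
    elem j′                 ∎)
    where open ≡-Reasoning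

∣p∣≡∣p∩q∣+∣p∩∁q∣ : ∀ {n} (p q : Subset n) → ∣ p ∣ ≡ ∣ p ∩ q ∣ + ∣ p ∩ ∁ q ∣
∣p∣≡∣p∩q∣+∣p∩∁q∣ []            []            = refl
∣p∣≡∣p∩q∣+∣p∩∁q∣ (outside ∷ p) (_ ∷ q)       = ∣p∣≡∣p∩q∣+∣p∩∁q∣ p q
∣p∣≡∣p∩q∣+∣p∩∁q∣ (inside ∷ p)  (inside ∷ q)  = cong suc (∣p∣≡∣p∩q∣+∣p∩∁q∣ p q)
∣p∣≡∣p∩q∣+∣p∩∁q∣ (inside ∷ p)  (outside ∷ q) =
  trans (cong suc (∣p∣≡∣p∩q∣+∣p∩∁q∣ p q)) (sym (+-suc _ _))

0<∣p∣⇒nonempty : ∀ {n} (p : Subset n) → 0 < ∣ p ∣ → Nonempty p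
0<∣p∣⇒nonempty p 0<∣p∣ = elem j , elem∈ j
  where
  open Enumeration (enumerate p)
  j = fromℕ< 0<∣p∣

x∈p⇒0<∣p∣ : ∀ {n} {p : Subset n} {x} → x ∈ p → 0 < ∣ p ∣
x∈p⇒0<∣p∣ x∈p = ≤-trans (s≤s z≤n) (x∈p⇒∣p-x∣<∣p∣ x∈p)

∈-tabulate⁺ : ∀ {n} {f : Fin n → Bool} {x} → f x ≡ true → x ∈ tabulate f
∈-tabulate⁺ {f = f} {x} fx = lookup⇒[]= x (tabulate f) (trans (lookup∘tabulate f x) fx)

∈-tabulate⁻ : ∀ {n} {f : Fin n → Bool} {x} → x ∈ tabulate f → f x ≡ true
∈-tabulate⁻ {f = f} {x} x∈ = trans (sym (lookup∘tabulate f x)) ([]=⇒lookup x∈)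

minFin≤ : ∀ {m} (f : Fin (suc m) → ℕ) i → minFin f ≤ f i
minFin≤ {zero}  f fzero    = ≤-refl
minFin≤ {suc m} f fzero    = m⊓n≤m _ _
minFin≤ {suc m} f (fsuc i) = ≤-trans (m⊓n≤n _ _) (minFin≤ (f ∘ fsuc) i)

≤-minFin : ∀ {m c} (f : Fin (suc m) → ℕ) → (∀ i → c ≤ f i) → c ≤ minFin f
≤-minFin {zero}  f c≤f = c≤f fzero
≤-minFin {suc m} f c≤f = ⊓-glb (c≤f fzero) (≤-minFin (f ∘ fsuc) (c≤f ∘ fsuc))

minFin-attained : ∀ {m} (f : Fin (suc m) → ℕ) → ∃ λ i → f i ≡ minFin f
minFin-attained {zero}  f = fzero , refl
minFin-attained {suc m} f with ⊓-sel (f fzero) (minFin (f ∘ fsuc))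
... | inj₁ eq = fzero , sym eq
... | inj₂ eq = let i , fi≡ = minFin-attained (f ∘ fsuc) in fsuc i , trans fi≡ (sym eq)

∈-part⁺ : ∀ {n p} (Ω : Partition n p) {i x} → label Ω x ≡ i → x ∈ part Ω i
∈-part⁺ Ω {i} {x} eq =
  ∈-tabulate⁺ (trans (isYes≗does (label Ω x F.≟ i)) (dec-true (label Ω x F.≟ i) eq))

∈-part⁻ : ∀ {n p} (Ω : Partition n p) {i x} → x ∈ part Ω i → label Ω x ≡ i
∈-part⁻ Ω {i} {x} x∈ with label Ω x F.≟ i | ∈-tabulate⁻ {f = λ v → ⌊ label Ω v F.≟ i ⌋} x∈
... | yes eq | _ = eq

part-disjoint : ∀ {n p} (Ω : Partition n p) {i j} → i ≢ j → part Ω i ∩ part Ω j ≡ ⊥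
part-disjoint Ω i≢j = Empty-unique λ (x , x∈) →
  let x∈i , x∈j = x∈p∩q⁻ _ _ x∈ in i≢j (trans (sym (∈-part⁻ Ω x∈i)) (∈-part⁻ Ω x∈j))

module _ {n} (G : Graph n) where

  ∈-N⁺ : ∀ {v x} → adj G v x ≡ true → x ∈ N G v
  ∈-N⁺ = ∈-tabulate⁺

  ∈-N⁻ : ∀ {v x} → x ∈ N G v → adj G v x ≡ true
  ∈-N⁻ = ∈-tabulate⁻

  N-symmetric : ∀ {u v} → u ∈ N G v → v ∈ N G u
  N-symmetric {u} {v} u∈Nv = ∈-N⁺ (trans (symmetric G u v) (∈-N⁻ u∈Nv))

  v∉N[v] : ∀ v → v ∉ N G v
  v∉N[v] v v∈Nv with () ← trans (sym (loopless G v)) (∈-N⁻ v∈Nv)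

  singleton-¬TD : ∀ {k} → 1 ≤ k → ∀ x → ¬ TotalDominating k G ⁅ x ⁆
  singleton-¬TD 1≤k x td =
    let y , y∈ = 0<∣p∣⇒nonempty (N G x ∩ ⁅ x ⁆) (≤-trans 1≤k (td x))
        y∈N , y∈⁅x⁆ = x∈p∩q⁻ _ _ y∈
    in v∉N[v] x (subst (_∈ N G x) (x∈⁅y⁆⇒x≡y x y∈⁅x⁆) y∈N)

  TD⇒1+k≤∣S∣ : ∀ {k S} → 1 ≤ k → Fin n → TotalDominating k G S → suc k ≤ ∣ S ∣
  TD⇒1+k≤∣S∣ {k} {S} 1≤k v td with 0<∣p∣⇒nonempty (N G v ∩ S) (≤-trans 1≤k (td v))
  ... | x , x∈N∩S = begin
    suc k                              ≡⟨ +-comm 1 k ⟩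
    k + 1                              ≤⟨ +-mono-≤ k≤∣S∩N∣ (x∈p⇒0<∣p∣ x∈S∩∁N) ⟩
    ∣ S ∩ N G x ∣ + ∣ S ∩ ∁ (N G x) ∣  ≡⟨ ∣p∣≡∣p∩q∣+∣p∩∁q∣ S (N G x) ⟨
    ∣ S ∣                              ∎
    where
    open ≤-Reasoning
    k≤∣S∩N∣ : k ≤ ∣ S ∩ N G x ∣
    k≤∣S∩N∣ = subst (k ≤_) (cong ∣_∣ (∩-comm (N G x) S)) (td x)
    x∈S∩∁N : x ∈ S ∩ ∁ (N G x)
    x∈S∩∁N = x∈p∩q⁺ (proj₂ (x∈p∩q⁻ _ _ x∈N∩S) , x∉p⇒x∈∁p (v∉N[v] x))

  regular⇒TD≡⊤ : ∀ {k S} → 1 ≤ k → (∀ v → degree G v ≡ k) → TotalDominating k G S → S ≡ ⊤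
  regular⇒TD≡⊤ {k} {S} 1≤k regular td = ⊆-antisym ⊆⊤ ⊤⊆S
    where
    N⊆S : ∀ v → N G v ⊆ S
    N⊆S v x∈N = x∉∁p⇒x∈p λ x∈∁S → <-irrefl refl (begin-strict
      k                               ≡⟨ +-identityʳ k ⟨
      k + 0                           <⟨ +-monoʳ-< k (x∈p⇒0<∣p∣ (x∈p∩q⁺ (x∈N , x∈∁S))) ⟩
      k + ∣ N G v ∩ ∁ S ∣             ≤⟨ +-monoˡ-≤ ∣ N G v ∩ ∁ S ∣ (td v) ⟩
      ∣ N G v ∩ S ∣ + ∣ N G v ∩ ∁ S ∣ ≡⟨ ∣p∣≡∣p∩q∣+∣p∩∁q∣ (N G v) S ⟨
      ∣ N G v ∣                       ≡⟨ regular v ⟩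
      k                               ∎)
      where open ≤-Reasoning
    ⊤⊆S : ⊤ ⊆ S
    ⊤⊆S {u} _ with 0<∣p∣⇒nonempty (N G u) (≤-trans 1≤k (≤-reflexive (sym (regular u))))
    ... | w , w∈N[u] = N⊆S w (N-symmetric w∈N[u])

tcPartition-size≤ : ∀ {n k t p} (G : Graph n) → (∀ S → TotalDominating k G S → t ≤ ∣ S ∣) →
  HasTCPartition k G p → p ≤ n ∸ t + 2
tcPartition-size≤ {p = zero}     _ _ _ = z≤n
tcPartition-size≤ {p = suc zero} _ _ (Ω , coalition) with coalition fzero
... | fzero , 0≢0 , _ = contradiction refl 0≢0
tcPartition-size≤ {n} {t = t} {p = suc (suc p)} G t≤∣TD∣ (Ω , coalition) with coalition fzero
... | fzero  , 0≢0 , _ = contradiction refl 0≢0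
... | fsuc j , _ , _ , _ , _ , U-TD = subst (_≤ n ∸ t + 2) (+-comm p 2) (+-monoˡ-≤ 2 p≤n∸t)
  where
  U = part Ω fzero ∪ part Ω (fsuc j)
  -- fsuc ∘ punchIn j enumerates the parts other than 0 and 1 + j
  other : Fin p → Fin n
  other s = proj₁ (surjective Ω (fsuc (punchIn j s)))
  other-label : ∀ s → label Ω (other s) ≡ fsuc (punchIn j s)
  other-label s = proj₂ (surjective Ω (fsuc (punchIn j s)))
  other-injective : Injective _≡_ _≡_ other
  other-injective {s} {s′} eq = punchIn-injective j s s′ (suc-injective (begin
    fsuc (punchIn j s)  ≡⟨ other-label s ⟨
    label Ω (other s)   ≡⟨ cong (label Ω) eq ⟩
    label Ω (other s′)  ≡⟨ other-label s′ ⟩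
    fsuc (punchIn j s′) ∎))
    where open ≡-Reasoning
  other∈∁U : ∀ s → other s ∈ ∁ U
  other∈∁U s = x∉p⇒x∈∁p λ other∈U → case x∈p∪q⁻ _ _ other∈U of λ where
    (inj₁ ∈part₀) → 0≢1+n (trans (sym (∈-part⁻ Ω ∈part₀)) (other-label s))
    (inj₂ ∈partⱼ) → punchInᵢ≢i j s (suc-injective (trans (sym (other-label s)) (∈-part⁻ Ω ∈partⱼ)))
  p≤n∸t : p ≤ n ∸ t
  p≤n∸t = begin
    p         ≤⟨ injection⇒≤∣p∣ other other-injective other∈∁U ⟩
    ∣ ∁ U ∣   ≡⟨ ∣∁p∣≡n∸∣p∣ U ⟩
    n ∸ ∣ U ∣ ≤⟨ ∸-monoʳ-≤ n (t≤∣TD∣ U U-TD) ⟩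
    n ∸ t     ∎
    where open ≤-Reasoning

TC≡-intro : ∀ {n k t p} (G : Graph n) → (∀ q → HasTCPartition k G q → q ≤ t) →
  HasTCPartition k G p → t ≤ p → TC≡ k G t
TC≡-intro G ≤t has t≤p = subst (HasTCPartition _ G) (≤-antisym (≤t _ has) t≤p) has , ≤t

module StarPartition {n q} (g : Fin (suc q) → Fin n) (g-injective : Injective _≡_ _≡_ g) where

  preimage? : ∀ x → Dec (∃ λ i → g i ≡ x)
  preimage? x = any? (λ i → g i F.≟ x)

  image : Subset n
  image = tabulate (λ x → ⌊ preimage? x ⌋)

  ∈-image⁺ : ∀ i → g i ∈ image
  ∈-image⁺ i = ∈-tabulate⁺ (trans (isYes≗does (preimage? (g i))) (dec-true (preimage? (g i)) (i , refl)))

  ∈-image⁻ : ∀ {x} → x ∈ image → ∃ λ i → g i ≡ x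
  ∈-image⁻ {x} x∈ with preimage? x | ∈-tabulate⁻ {f = λ x → ⌊ preimage? x ⌋} x∈
  ... | yes gi≡x | _ = gi≡x

  ∣∁[∁image∪⁅gᵢ⁆]∣≤q : ∀ i → ∣ ∁ (∁ image ∪ ⁅ g i ⁆) ∣ ≤ q
  ∣∁[∁image∪⁅gᵢ⁆]∣≤q i = covering⇒∣p∣≤ (g ∘ punchIn i) covered
    where
    covered : ∀ {x} → x ∈ ∁ (∁ image ∪ ⁅ g i ⁆) → ∃ λ j → g (punchIn i j) ≡ x
    covered x∈ with ∈-image⁻ (x∉∁p⇒x∈p (x∈∁p⇒x∉p x∈ ∘ p⊆p∪q ⁅ g i ⁆))
    ... | j , gj≡x with i F.≟ j
    ...   | no i≢j   = punchOut i≢j , trans (cong g (punchIn-punchOut i≢j)) gj≡x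
    ...   | yes refl = contradiction (q⊆p∪q (∁ image) ⁅ g i ⁆ (subst (_∈ ⁅ g i ⁆) gj≡x (x∈⁅x⁆ (g i))))
                                     (x∈∁p⇒x∉p x∈)

  ∁image∪⁅gᵢ⁆-TD : ∀ {k} (G : Graph n) → (∀ w → q + k ≤ degree G w) →
    ∀ i → TotalDominating k G (∁ image ∪ ⁅ g i ⁆)
  ∁image∪⁅gᵢ⁆-TD {k} G q+k≤deg i w = +-cancelˡ-≤ q k ∣ N G w ∩ S ∣ (begin
    q + k                           ≤⟨ q+k≤deg w ⟩
    ∣ N G w ∣                       ≡⟨ ∣p∣≡∣p∩q∣+∣p∩∁q∣ (N G w) S ⟩
    ∣ N G w ∩ S ∣ + ∣ N G w ∩ ∁ S ∣ ≤⟨ +-monoʳ-≤ ∣ N G w ∩ S ∣ ∣N[w]∩∁S∣≤q ⟩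
    ∣ N G w ∩ S ∣ + q               ≡⟨ +-comm _ q ⟩
    q + ∣ N G w ∩ S ∣               ∎)
    where
    open ≤-Reasoning
    S = ∁ image ∪ ⁅ g i ⁆
    ∣N[w]∩∁S∣≤q : ∣ N G w ∩ ∁ S ∣ ≤ q
    ∣N[w]∩∁S∣≤q = ≤-trans (∣p∩q∣≤∣q∣ (N G w) (∁ S)) (∣∁[∁image∪⁅gᵢ⁆]∣≤q i)

  ∁image-¬TD : ∀ {k} (G : Graph n) v → (∀ i → g i ∈ N G v) → degree G v < suc q + k →
    ¬ TotalDominating k G (∁ image)
  ∁image-¬TD {k} G v g∈N[v] deg<1+q+k td = <⇒≱ deg<1+q+k (begin
    suc q + k                               ≤⟨ +-mono-≤ 1+q≤∣N[v]∩image∣ (td v) ⟩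
    ∣ N G v ∩ image ∣ + ∣ N G v ∩ ∁ image ∣ ≡⟨ ∣p∣≡∣p∩q∣+∣p∩∁q∣ (N G v) image ⟨
    ∣ N G v ∣                               ∎)
    where
    open ≤-Reasoning
    1+q≤∣N[v]∩image∣ : suc q ≤ ∣ N G v ∩ image ∣
    1+q≤∣N[v]∩image∣ = injection⇒≤∣p∣ g g-injective (λ i → x∈p∩q⁺ (g∈N[v] i , ∈-image⁺ i))

  labelBy : ∀ {x} → Dec (∃ λ i → g i ≡ x) → Fin (suc (suc q))
  labelBy (yes (i , _)) = fsuc i
  labelBy (no _)        = fzero

  starLabel : Fin n → Fin (suc (suc q))
  starLabel x = labelBy (preimage? x)

  starLabel-g : ∀ i → starLabel (g i) ≡ fsuc i
  starLabel-g i with preimage? (g i)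
  ... | yes (j , gj≡gi) = cong fsuc (g-injective gj≡gi)
  ... | no ∄j           = contradiction (i , refl) ∄j

  starLabel-∉image : ∀ {x} → x ∉ image → starLabel x ≡ fzero
  starLabel-∉image {x} x∉ with preimage? x
  ... | yes (i , gi≡x) = contradiction (subst (_∈ image) gi≡x (∈-image⁺ i)) x∉
  ... | no _           = refl

  starLabel≡0⇒∉image : ∀ {x} → starLabel x ≡ fzero → x ∉ image
  starLabel≡0⇒∉image {x} label≡0 x∈ with preimage? x
  starLabel≡0⇒∉image () x∈ | yes _
  ... | no ∄i = ∄i (∈-image⁻ x∈)

  starLabel≡1+i⇒≡g : ∀ {x i} → starLabel x ≡ fsuc i → x ≡ g i
  starLabel≡1+i⇒≡g {x} label≡1+i with preimage? x
  starLabel≡1+i⇒≡g refl | yes (_ , gi≡x) = sym gi≡x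

  starPartition : ∀ {x₀} → x₀ ∉ image → Partition n (suc (suc q))
  starPartition {x₀} x₀∉ = record { label = starLabel ; surjective = surjective′ }
    where
    surjective′ : ∀ j → ∃ λ x → starLabel x ≡ j
    surjective′ fzero    = x₀ , starLabel-∉image x₀∉
    surjective′ (fsuc i) = g i , starLabel-g i

  module _ {x₀} (x₀∉ : x₀ ∉ image) where

    Ω = starPartition x₀∉

    part₀≡∁image : part Ω fzero ≡ ∁ image
    part₀≡∁image = ⊆-antisym
      (λ x∈ → x∉p⇒x∈∁p (starLabel≡0⇒∉image (∈-part⁻ Ω x∈)))
      (λ x∈ → ∈-part⁺ Ω (starLabel-∉image (x∈∁p⇒x∉p x∈)))

    part₁₊ᵢ≡⁅gᵢ⁆ : ∀ i → part Ω (fsuc i) ≡ ⁅ g i ⁆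
    part₁₊ᵢ≡⁅gᵢ⁆ i = ⊆-antisym
      (λ x∈ → subst (_∈ ⁅ g i ⁆) (sym (starLabel≡1+i⇒≡g (∈-part⁻ Ω x∈))) (x∈⁅x⁆ (g i)))
      (λ {x} x∈ → ∈-part⁺ Ω (subst (λ y → starLabel y ≡ fsuc i) (sym (x∈⁅y⁆⇒x≡y _ x∈)) (starLabel-g i)))

    module _ {k} (G : Graph n) (1≤k : 1 ≤ k) (¬td₀ : ¬ TotalDominating k G (∁ image))
             (tdᵢ : ∀ i → TotalDominating k G (∁ image ∪ ⁅ g i ⁆)) where

      part₀-¬TD : ¬ TotalDominating k G (part Ω fzero)
      part₀-¬TD = ¬td₀ ∘ subst (TotalDominating k G) part₀≡∁image

      part₁₊ᵢ-¬TD : ∀ i → ¬ TotalDominating k G (part Ω (fsuc i))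
      part₁₊ᵢ-¬TD i = singleton-¬TD G 1≤k (g i) ∘ subst (TotalDominating k G) (part₁₊ᵢ≡⁅gᵢ⁆ i)

      part₀∪part₁₊ᵢ-TD : ∀ i → TotalDominating k G (part Ω fzero ∪ part Ω (fsuc i))
      part₀∪part₁₊ᵢ-TD i = subst (TotalDominating k G)
        (sym (cong₂ _∪_ part₀≡∁image (part₁₊ᵢ≡⁅gᵢ⁆ i))) (tdᵢ i)

      isTCPartition : IsTotalCoalitionPartition k G Ω
      isTCPartition fzero    = fsuc fzero , (λ ()) , part-disjoint Ω (λ ()) ,
        part₀-¬TD , part₁₊ᵢ-¬TD fzero , part₀∪part₁₊ᵢ-TD fzero
      isTCPartition (fsuc i) = fzero , (λ ()) , part-disjoint Ω (λ ()) ,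
        part₁₊ᵢ-¬TD i , part₀-¬TD , subst (TotalDominating k G) (∪-comm _ _) (part₀∪part₁₊ᵢ-TD i)

tcPartition-δ∸k+2 : ∀ {m k} (G : Graph (suc m)) → 1 ≤ k → k ≤ δ G → HasTCPartition k G (δ G ∸ k + 2)
tcPartition-δ∸k+2 {m} {k} G 1≤k k≤δ = subst (HasTCPartition k G) (+-comm 2 d)
  ( starPartition v∉image
  , isTCPartition v∉image G 1≤k
      (∁image-¬TD G v (elem∈ ∘ ι) (≤-reflexive (cong suc (trans ∣N[v]∣≡δ (sym d+k≡δ)))))
      (∁image∪⁅gᵢ⁆-TD G λ w → ≤-trans (≤-reflexive d+k≡δ) (minFin≤ (degree G) w)) )
  where
  d = δ G ∸ k
  d+k≡δ : d + k ≡ δ G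
  d+k≡δ = m∸n+n≡m k≤δ
  v = proj₁ (minFin-attained (degree G))
  ∣N[v]∣≡δ : ∣ N G v ∣ ≡ δ G
  ∣N[v]∣≡δ = proj₂ (minFin-attained (degree G))
  1+d≤∣N[v]∣ : suc d ≤ ∣ N G v ∣
  1+d≤∣N[v]∣ = ≤-trans (≤-reflexive (+-comm 1 d))
    (≤-trans (+-monoʳ-≤ d 1≤k) (≤-reflexive (trans d+k≡δ (sym ∣N[v]∣≡δ))))
  open Enumeration (enumerate (N G v))
  ι : Fin (suc d) → Fin ∣ N G v ∣
  ι i = inject≤ i 1+d≤∣N[v]∣
  open StarPartition (elem ∘ ι) (inject≤-injective _ _ _ _ ∘ injective)
  v∉image : v ∉ image
  v∉image v∈ = let i , gi≡v = ∈-image⁻ v∈ in v∉N[v] G v (subst (_∈ N G v) gi≡v (elem∈ (ι i)))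

next : ∀ {m} → Fin (suc m) → Fin (suc m)
next x with view x
... | ‵fromℕ     = fzero
... | ‵inject₁ i = fsuc i

prev : ∀ {m} → Fin (suc m) → Fin (suc m)
prev {m} fzero = fromℕ m
prev (fsuc i)  = inject₁ i

prev-next : ∀ {m} (x : Fin (suc m)) → prev (next x) ≡ x
prev-next x with view x
... | ‵fromℕ     = refl
... | ‵inject₁ _ = refl

next-prev : ∀ {m} (x : Fin (suc m)) → next (prev x) ≡ x
next-prev {m} fzero rewrite view-fromℕ m = refl
next-prev (fsuc i) rewrite view-inject₁ i = refl

toℕ-next : ∀ {m} (x : Fin (suc m)) → toℕ (next x) ≡ suc (toℕ x) % suc m
toℕ-next {m} x with view x
... | ‵fromℕ     rewrite toℕ-fromℕ m = sym (n%n≡0 (suc m))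
... | ‵inject₁ i rewrite toℕ-inject₁ i = sym (m<n⇒m%n≡m (s≤s (toℕ<n i)))

prev∘prev≢id : ∀ {m} → 2 ≤ m → (x : Fin (suc m)) → prev (prev x) ≢ x
prev∘prev≢id (s≤s (s≤s _)) fzero           ()
prev∘prev≢id (s≤s (s≤s _)) (fsuc fzero)    ()
prev∘prev≢id (s≤s (s≤s _)) (fsuc (fsuc j)) eq =
  m≢1+n+m (toℕ j) (trans (sym (trans (toℕ-inject₁ (inject₁ j)) (toℕ-inject₁ j))) (cong toℕ eq))

cycleAdj-next : ∀ {m} (u : Fin (suc m)) → cycleAdj u (next u) ≡ true
cycleAdj-next {m} u with toℕ (next u) ℕ.≟ suc (toℕ u) % suc m
... | yes _     = refl
... | no ≢next = contradiction (toℕ-next u) ≢next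

cycleAdj⇒next⊎prev : ∀ {m} {u v : Fin (suc m)} → cycleAdj u v ≡ true → v ≡ next u ⊎ v ≡ prev u
cycleAdj⇒next⊎prev {m} {u} {v} adj-uv
  with toℕ v ℕ.≟ suc (toℕ u) % suc m | toℕ u ℕ.≟ suc (toℕ v) % suc m
... | yes v≡u+1 | _         = inj₁ (toℕ-injective (trans v≡u+1 (sym (toℕ-next u))))
... | no _      | yes u≡v+1 =
  inj₂ (trans (sym (prev-next v)) (cong prev (toℕ-injective (trans (toℕ-next v) (sym u≡v+1)))))

cycle-degree : ∀ {m} (G : Graph (suc m)) → 2 ≤ m → (∀ u v → adj G u v ≡ cycleAdj u v) →
  ∀ u → degree G u ≡ 2
cycle-degree {m} G 2≤m isCycle u =
  ≤-antisym (covering⇒∣p∣≤ neighbour covers) (injection⇒≤∣p∣ neighbour neighbour-injective neighbour∈N)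
  where
  neighbour : Fin 2 → Fin (suc m)
  neighbour fzero        = next u
  neighbour (fsuc fzero) = prev u
  covers : ∀ {x} → x ∈ N G u → ∃ λ i → neighbour i ≡ x
  covers x∈ with cycleAdj⇒next⊎prev (trans (sym (isCycle u _)) (∈-N⁻ G x∈))
  ... | inj₁ x≡next = fzero , sym x≡next
  ... | inj₂ x≡prev = fsuc fzero , sym x≡prev
  next≢prev : next u ≢ prev u
  next≢prev eq = prev∘prev≢id 2≤m u (trans (cong prev (sym eq)) (prev-next u))
  neighbour-injective : Injective _≡_ _≡_ neighbour
  neighbour-injective {fzero}      {fzero}      _  = refl
  neighbour-injective {fzero}      {fsuc fzero} eq = contradiction eq next≢prev
  neighbour-injective {fsuc fzero} {fzero}      eq = contradiction (sym eq) next≢prev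
  neighbour-injective {fsuc fzero} {fsuc fzero} _  = refl
  neighbour∈N : ∀ i → neighbour i ∈ N G u
  neighbour∈N fzero        = ∈-N⁺ G (trans (isCycle u (next u)) (cycleAdj-next u))
  neighbour∈N (fsuc fzero) = ∈-N⁺ G (trans (symmetric G u (prev u)) (trans (isCycle (prev u) u)
    (subst (λ x → cycleAdj (prev u) x ≡ true) (next-prev u) (cycleAdj-next (prev u)))))

complete-degree : ∀ {n} (G : Graph n) → (∀ u v → adj G u v ≡ completeAdj u v) →
  ∀ u → n ∸ 1 ≤ degree G u
complete-degree {n} G isComplete u = begin
  n ∸ 1           ≡⟨ cong (n ∸_) (∣⁅x⁆∣≡1 u) ⟨
  n ∸ ∣ ⁅ u ⁆ ∣   ≡⟨ ∣∁p∣≡n∸∣p∣ ⁅ u ⁆ ⟨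
  ∣ ∁ ⁅ u ⁆ ∣     ≤⟨ p⊆q⇒∣p∣≤∣q∣ ∁⁅u⁆⊆N[u] ⟩
  ∣ N G u ∣       ∎
  where
  open ≤-Reasoning
  ∁⁅u⁆⊆N[u] : ∁ ⁅ u ⁆ ⊆ N G u
  ∁⁅u⁆⊆N[u] {x} x∈ = ∈-N⁺ G (trans (isComplete u x) (cong not (trans (isYes≗does (u F.≟ x))
    (dec-false (u F.≟ x) (x∉⁅y⁆⇒x≢y (x∈∁p⇒x∉p x∈) ∘ sym)))))

TC₂-cycle : ∀ (m : ℕ) (G : Graph (suc m)) → 3 ≤ suc m → (∀ u v → adj G u v ≡ cycleAdj u v) →
  TC≡ 2 G 2
TC₂-cycle m G (s≤s 2≤m) isCycle = TC≡-intro G ≤2 (tcPartition-δ∸k+2 G (s≤s z≤n) 2≤δ) (m≤n+m 2 _)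
  where
  2-regular : ∀ u → degree G u ≡ 2
  2-regular = cycle-degree G 2≤m isCycle
  2≤δ : 2 ≤ δ G
  2≤δ = ≤-minFin (degree G) (≤-reflexive ∘ sym ∘ 2-regular)
  n≤∣TD∣ : ∀ S → TotalDominating 2 G S → suc m ≤ ∣ S ∣
  n≤∣TD∣ S td =
    ≤-reflexive (sym (trans (cong ∣_∣ (regular⇒TD≡⊤ G {S = S} (s≤s z≤n) 2-regular td)) (∣⊤∣≡n _)))
  ≤2 : ∀ p → HasTCPartition 2 G p → p ≤ 2
  ≤2 p has = subst (p ≤_) (cong (_+ 2) (n∸n≡0 m)) (tcPartition-size≤ G n≤∣TD∣ has)

TCₖ-complete : ∀ (k n : ℕ) (G : Graph n) → 1 ≤ k → k + 1 ≤ n →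
  (∀ u v → adj G u v ≡ completeAdj u v) → TC≡ k G (n ∸ k + 1)
TCₖ-complete k zero    G _   k+1≤0 _ with () ← m+n≤o⇒n≤o k k+1≤0
TCₖ-complete k (suc m) G 1≤k k+1≤n isComplete =
  subst (TC≡ k G) (sym 1+m∸k+1≡m∸k+2)
    (TC≡-intro G ≤m∸k+2 (tcPartition-δ∸k+2 G 1≤k (≤-trans k≤m m≤δ)) (+-monoˡ-≤ 2 (∸-monoˡ-≤ k m≤δ)))
  where
  k≤m : k ≤ m
  k≤m = s≤s⁻¹ (subst (_≤ suc m) (+-comm k 1) k+1≤n)
  m≤δ : m ≤ δ G
  m≤δ = ≤-minFin (degree G) (complete-degree G isComplete)
  1+m∸k+1≡m∸k+2 : suc m ∸ k + 1 ≡ m ∸ k + 2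
  1+m∸k+1≡m∸k+2 = trans (cong (_+ 1) (+-∸-assoc 1 k≤m)) (sym (+-suc (m ∸ k) 1))
  ≤m∸k+2 : ∀ p → HasTCPartition k G p → p ≤ m ∸ k + 2
  ≤m∸k+2 p = tcPartition-size≤ G (λ S → TD⇒1+k≤∣S∣ G {S = S} 1≤k fzero)

theorem3p1 : (∀ (k m : ℕ) (G : Graph (suc m)) → 1 ≤ k → k ≤ δ G →
       Σ ℕ λ p → HasTCPartition k G p × (δ G ∸ k + 2 ≤ p))
    × (∀ (m : ℕ) (G : Graph (suc m)) → 3 ≤ suc m → (∀ u v → adj G u v ≡ cycleAdj u v) →
       TC≡ 2 G 2)
    × (∀ (k n : ℕ) (G : Graph n) → 1 ≤ k → k + 1 ≤ n → (∀ u v → adj G u v ≡ completeAdj u v) →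
       TC≡ k G (n ∸ k + 1))
theorem3p1 = (λ k m G 1≤k k≤δ → _ , tcPartition-δ∸k+2 G 1≤k k≤δ , ≤-refl) , TC₂-cycle , TCₖ-complete
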